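{- For every $n \geq 3$, the graph $\mathcal{T}_n$ is a nut graph.
   Context: $\mathcal{T}_n$ is the graph obtained from the $n$-cycle $C_n$ by fusing a triangle to every vertex: for each vertex $i$ of the cycle, add two new vertices that are adjacent to each other and to $i$ (so $\mathcal{T}_n$ has $3n$ vertices). A nut graph is a simple connected graph whose adjacency matrix has one-dimensional kernel spanned by a vector with no zero entry.
   Formalization: The kernel of the adjacency matrix is taken over the rationals. -}

module Defs where

open import Data.Nat as ℕ using (ℕ; zero; suc)
open import Data.Fin as Fin using (Fin; toℕ; remQuot)
open import Data.Bool using (Bool; true; false; _∧_; _∨_; not; if_then_else_)
open import Data.Product using (Σ; ∃; _×_; _,_)
open import Data.Rational using (ℚ; 0ℚ; 1ℚ; _+_; _*_)
open import Relation.Nullary using (¬_)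
open import Relation.Nullary.Decidable using (⌊_⌋)
open import Relation.Binary.PropositionalEquality using (_≡_)

Adj : ℕ → Set
Adj m = Fin m → Fin m → Bool

IsSimple : ∀ {m} → Adj m → Set
IsSimple {m} adj = (∀ u v → adj u v ≡ adj v u) × (∀ u → adj u u ≡ false)

data Reach {m : ℕ} (adj : Adj m) : Fin m → Fin m → Set where
  here : ∀ {u} → Reach adj u u
  step : ∀ {u w v} → adj u w ≡ true → Reach adj w v → Reach adj u v

Connected : ∀ {m} → Adj m → Set
Connected adj = ∀ u v → Reach adj u v

sumℚ : ∀ {m} → (Fin m → ℚ) → ℚ
sumℚ {zero}  f = 0ℚ
sumℚ {suc m} f = f Fin.zero + sumℚ (λ i → f (Fin.suc i))

adjMatrix : ∀ {m} → Adj m → Fin m → Fin m → ℚ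
adjMatrix adj u v = if adj u v then 1ℚ else 0ℚ

InKernel : ∀ {m} → Adj m → (Fin m → ℚ) → Set
InKernel {m} adj x = ∀ u → sumℚ (λ v → adjMatrix adj u v * x v) ≡ 0ℚ

NutKernel : ∀ {m} → Adj m → Set
NutKernel {m} adj =
  Σ (Fin m → ℚ) λ v →
    (∀ u → ¬ (v u ≡ 0ℚ)) ×
    InKernel adj v ×
    (∀ x → InKernel adj x → ∃ λ c → ∀ u → x u ≡ c * v u)

IsNutGraph : ∀ {m} → Adj m → Set
IsNutGraph adj = IsSimple adj × Connected adj × NutKernel adj

cycAdj : (n : ℕ) → Fin n → Fin n → Bool
cycAdj n i j =
  ⌊ suc (toℕ i) ℕ.≟ toℕ j ⌋ ∨ ⌊ suc (toℕ j) ℕ.≟ toℕ i ⌋ ∨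
  (⌊ suc (toℕ i) ℕ.≟ n ⌋ ∧ ⌊ toℕ j ℕ.≟ 0 ⌋) ∨
  (⌊ suc (toℕ j) ℕ.≟ n ⌋ ∧ ⌊ toℕ i ℕ.≟ 0 ⌋)

-- Adjacency of T_n on pairs (i , a) with i : Fin n, a : Fin 3;
-- (i , 0) is the cycle vertex i, (i , 1) and (i , 2) its triangle vertices.
TAdjPair : (n : ℕ) → Fin n × Fin 3 → Fin n × Fin 3 → Bool
TAdjPair n (i , a) (j , b) =
  if ⌊ i Fin.≟ j ⌋
  then not ⌊ a Fin.≟ b ⌋
  else (⌊ toℕ a ℕ.≟ 0 ⌋ ∧ ⌊ toℕ b ℕ.≟ 0 ⌋ ∧ cycAdj n i j)

TAdj : (n : ℕ) → Adj (n ℕ.* 3)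
TAdj n u v = TAdjPair n (remQuot 3 u) (remQuot 3 v)

-- Write a kernel vector as y (i , a), with a = 0 on the cycle and a = 1, 2 on the triangle
-- at i. The rows of the two triangle vertices force y (i , 1) = y (i , 2) = - y (i , 0), and
-- the row of the cycle vertex i then reads y (i - 1 , 0) + y (i + 1 , 0) = 2 y (i , 0).
-- Hence y (· , 0) is an arithmetic progression along the cycle; closing it up gives
-- n · d = 0, so d = 0 and the kernel is spanned by the vector that is 1 on the cycle and
-- -1 on the triangles.

module Submission where

open import Defs
open import Data.Nat using (_≤_)

open import Data.Nat as ℕ using (ℕ; zero; suc; _<_; z≤n; s≤s)
import Data.Nat.Properties as ℕ
open import Data.Nat.DivMod using (_mod_; m<n⇒m%n≡m; m%n<n)
open import Data.Fin as Fin using (Fin; zero; suc; toℕ; _↑ˡ_; _↑ʳ_; combine; remQuot; punchIn)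
open import Data.Fin.Patterns using (0F; 1F; 2F)
open import Data.Fin.Properties using (punchInᵢ≢i; toℕ-injective; toℕ-fromℕ<; toℕ<n; remQuot-combine; combine-remQuot)
open import Data.Bool using (Bool; true; false; T; not; _∧_; _∨_; if_then_else_)
open import Data.Bool.Properties using (T-∨; T-∧; T-≡; ∨-assoc; ∨-comm; ∧-assoc; ∧-comm)
open import Data.Product using (∃; ∃₂; _×_; _,_; proj₁; proj₂)
open import Data.Product.Function.NonDependent.Propositional using (_×-⇔_)
open import Data.Sum using (_⊎_; inj₁; inj₂; [_,_]′)
open import Data.Sum.Function.Propositional using (_⊎-⇔_)
open import Data.Rational using (ℚ; 0ℚ; 1ℚ; _+_; _*_; -_; _-_; +-0-rawMonoid) renaming (_<_ to _<ℚ_)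
open import Data.Rational.Properties
  using (+-0-commutativeMonoid; +-0-group; +-identityˡ; +-identityʳ; +-assoc; *-identityˡ; *-identityʳ; *-zeroˡ;
         neg-distribʳ-*; +-mono-<; +-monoˡ-<; <-cmp; <-irrefl)
open import Data.Rational.Solver using (module +-*-Solver)
open import Algebra.Properties.Group +-0-group using (inverseʳ-unique)
open import Algebra.Definitions.RawMonoid +-0-rawMonoid using () renaming (_×_ to _·_)
open import Algebra.Properties.CommutativeMonoid.Sum +-0-commutativeMonoid
  using (sum; sum-cong-≗; sum-remove; sum-replicate-zero)
open import Data.Vec.Functional using (updateAt)
open import Data.Vec.Functional.Properties using (updateAt-updates; updateAt-minimal)
open import Function using (_∘_; const; _⇔_; mk⇔; Equivalence)
open import Function.Properties.Equivalence using () renaming (trans to ⇔-trans)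
open import Relation.Nullary using (¬_; Dec; yes; no; contradiction)
open import Relation.Nullary.Decidable using (⌊_⌋; toWitness; fromWitness)
open import Relation.Binary using (tri<; tri≈; tri>)
open import Relation.Binary.PropositionalEquality
open ≡-Reasoning
open +-*-Solver using (solve; _:+_; :-_; _:=_; con)

-- Finite sums

sumℚ≡sum : ∀ {m} (f : Fin m → ℚ) → sumℚ f ≡ sum f
sumℚ≡sum {zero}  f = refl
sumℚ≡sum {suc m} f = cong (f zero +_) (sumℚ≡sum (f ∘ suc))

sum-vanishing : ∀ {m} {f : Fin m → ℚ} → (∀ j → f j ≡ 0ℚ) → sum f ≡ 0ℚ
sum-vanishing {m} f≗0 = trans (sum-cong-≗ f≗0) (sum-replicate-zero m)

sum-extract : ∀ {m} (f : Fin m → ℚ) k → sum f ≡ f k + sum (updateAt f k (const 0ℚ))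
sum-extract {suc m} f k = begin
  sum f                                ≡⟨ sum-remove {i = k} f ⟩
  f k + sum (f ∘ punchIn k)            ≡⟨ cong (f k +_) (sym (+-identityˡ _)) ⟩
  f k + (0ℚ + sum (f ∘ punchIn k))     ≡⟨ cong (f k +_) (cong₂ _+_ (sym (updateAt-updates k f)) (sum-cong-≗ untouched)) ⟩
  f k + (f₀ k + sum (f₀ ∘ punchIn k))  ≡⟨ cong (f k +_) (sym (sum-remove {i = k} f₀)) ⟩
  f k + sum f₀                         ∎
  where
  f₀ = updateAt f k (const 0ℚ)
  untouched : ∀ j → f (punchIn k j) ≡ f₀ (punchIn k j)
  untouched j = sym (updateAt-minimal (punchIn k j) k f (punchInᵢ≢i k j))

updateAt-zero-vanishing : ∀ {m} {f : Fin m → ℚ} k {j} → (j ≢ k → f j ≡ 0ℚ) → updateAt f k (const 0ℚ) j ≡ 0ℚ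
updateAt-zero-vanishing {f = f} k {j} vanish with j Fin.≟ k
... | yes refl = updateAt-updates k f
... | no j≢k   = trans (updateAt-minimal j k f j≢k) (vanish j≢k)

sum-support₁ : ∀ {m} {f : Fin m → ℚ} k → (∀ j → j ≢ k → f j ≡ 0ℚ) → sum f ≡ f k
sum-support₁ {f = f} k vanish = begin
  sum f                               ≡⟨ sum-extract f k ⟩
  f k + sum (updateAt f k (const 0ℚ)) ≡⟨ cong (f k +_) (sum-vanishing (λ j → updateAt-zero-vanishing k (vanish j))) ⟩
  f k + 0ℚ                            ≡⟨ +-identityʳ _ ⟩
  f k                                 ∎

sum-support₂ : ∀ {m} {f : Fin m → ℚ} {k₁ k₂} → k₂ ≢ k₁ →
               (∀ j → j ≢ k₁ → j ≢ k₂ → f j ≡ 0ℚ) → sum f ≡ f k₁ + f k₂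
sum-support₂ {f = f} {k₁} {k₂} k₂≢k₁ vanish = begin
  sum f                                 ≡⟨ sum-extract f k₁ ⟩
  f k₁ + sum (updateAt f k₁ (const 0ℚ)) ≡⟨ cong (f k₁ +_) (sum-support₁ k₂ λ j j≢k₂ →
                                             updateAt-zero-vanishing k₁ λ j≢k₁ → vanish j j≢k₁ j≢k₂) ⟩
  f k₁ + updateAt f k₁ (const 0ℚ) k₂    ≡⟨ cong (f k₁ +_) (updateAt-minimal k₂ k₁ f k₂≢k₁) ⟩
  f k₁ + f k₂                           ∎

sum-support₃ : ∀ {m} {f : Fin m → ℚ} {k₁ k₂ k₃} → k₂ ≢ k₁ → k₃ ≢ k₁ → k₃ ≢ k₂ →
               (∀ j → j ≢ k₁ → j ≢ k₂ → j ≢ k₃ → f j ≡ 0ℚ) → sum f ≡ f k₁ + (f k₂ + f k₃)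
sum-support₃ {f = f} {k₁} {k₂} {k₃} k₂≢k₁ k₃≢k₁ k₃≢k₂ vanish = begin
  sum f                                 ≡⟨ sum-extract f k₁ ⟩
  f k₁ + sum (updateAt f k₁ (const 0ℚ)) ≡⟨ cong (f k₁ +_) (sum-support₂ k₃≢k₂ λ j j≢k₂ j≢k₃ →
                                             updateAt-zero-vanishing k₁ λ j≢k₁ → vanish j j≢k₁ j≢k₂ j≢k₃) ⟩
  f k₁ + (updateAt f k₁ (const 0ℚ) k₂ + updateAt f k₁ (const 0ℚ) k₃)
    ≡⟨ cong (f k₁ +_) (cong₂ _+_ (updateAt-minimal k₂ k₁ f k₂≢k₁) (updateAt-minimal k₃ k₁ f k₃≢k₁)) ⟩
  f k₁ + (f k₂ + f k₃)                  ∎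

sum-↑ : ∀ k {m} (f : Fin (k ℕ.+ m) → ℚ) → sum f ≡ sum (λ i → f (i ↑ˡ m)) + sum (λ i → f (k ↑ʳ i))
sum-↑ zero    f = sym (+-identityˡ _)
sum-↑ (suc k) {m} f = trans (cong (f zero +_) (sum-↑ k (f ∘ suc)))
  (sym (+-assoc (f zero) (sum (λ i → f (suc (i ↑ˡ m)))) (sum (λ i → f (suc k ↑ʳ i)))))

sum-combine : ∀ n {k} (f : Fin (n ℕ.* k) → ℚ) →
              sum f ≡ sum (λ (i : Fin n) → sum (λ (b : Fin k) → f (combine i b)))
sum-combine zero    f = refl
sum-combine (suc n) {k} f =
  trans (sum-↑ k f) (cong (sum (λ b → f (b ↑ˡ n ℕ.* k)) +_) (sum-combine n (λ v → f (k ↑ʳ v))))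

-- Harmonic sequences of rationals

·-zeroʳ : ∀ k → k · 0ℚ ≡ 0ℚ
·-zeroʳ zero    = refl
·-zeroʳ (suc k) = trans (cong (0ℚ +_) (·-zeroʳ k)) (+-identityˡ 0ℚ)

·-monoʳ-< : ∀ k {p q} → p <ℚ q → suc k · p <ℚ suc k · q
·-monoʳ-< zero    {p} {q} p<q = +-monoˡ-< 0ℚ p<q
·-monoʳ-< (suc k) p<q = +-mono-< p<q (·-monoʳ-< k p<q)

·-cancelˡ : ∀ k {p q} → suc k · p ≡ suc k · q → p ≡ q
·-cancelˡ k {p} {q} eq with <-cmp p q
... | tri< p<q _ _ = contradiction eq (λ e → <-irrefl e (·-monoʳ-< k p<q))
... | tri≈ _ p≡q _ = p≡q
... | tri> _ _ q<p = contradiction (sym eq) (λ e → <-irrefl e (·-monoʳ-< k q<p))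

harmonic⇒arithmetic : ∀ (s : ℕ → ℚ) N →
  (∀ k → 2 ℕ.+ k < N → s k + s (2 ℕ.+ k) ≡ s (1 ℕ.+ k) + s (1 ℕ.+ k)) →
  ∀ k → k < N → s k ≡ s 0 + k · (s 1 - s 0)
harmonic⇒arithmetic s N harmonic zero          _     = sym (+-identityʳ (s 0))
harmonic⇒arithmetic s N harmonic (suc zero)    _     =
  solve 2 (λ s₀ s₁ → s₁ := s₀ :+ ((s₁ :+ :- s₀) :+ con 0ℚ)) refl (s 0) (s 1)
harmonic⇒arithmetic s N harmonic (suc (suc k)) 2+k<N =
  extend {s₀ = s 0} {d = s 1 - s 0} (harmonic k 2+k<N)
    (harmonic⇒arithmetic s N harmonic k (ℕ.<-trans (ℕ.n<1+n k) 1+k<N))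
    (harmonic⇒arithmetic s N harmonic (suc k) 1+k<N)
  where
  1+k<N = ℕ.<-trans (ℕ.n<1+n (suc k)) 2+k<N
  extend : ∀ {a b c s₀ d t} → a + c ≡ b + b → a ≡ s₀ + t → b ≡ s₀ + (d + t) → c ≡ s₀ + (d + (d + t))
  extend {a} {b} {c} {s₀} {d} {t} a+c≡b+b refl refl = begin
    c                  ≡⟨ solve 2 (λ a c → c := (a :+ c) :+ :- a) refl a c ⟩
    (a + c) - a        ≡⟨ cong (_- a) a+c≡b+b ⟩
    (b + b) - a        ≡⟨ solve 3 (λ s₀ d t → ((s₀ :+ (d :+ t)) :+ (s₀ :+ (d :+ t))) :+ :- (s₀ :+ t)
                                              := s₀ :+ (d :+ (d :+ t))) refl s₀ d t ⟩
    s₀ + (d + (d + t)) ∎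

-- The cycle

CycleAdjacent : ℕ → ℕ → ℕ → Set
CycleAdjacent N a b = suc a ≡ b ⊎ suc b ≡ a ⊎ (suc a ≡ N × b ≡ 0) ⊎ (suc b ≡ N × a ≡ 0)

T-dec : ∀ {P : Set} (d : Dec P) → T ⌊ d ⌋ ⇔ P
T-dec d = mk⇔ toWitness fromWitness

T-cycAdj : ∀ {N} {i j : Fin N} → T (cycAdj N i j) ⇔ CycleAdjacent N (toℕ i) (toℕ j)
T-cycAdj {N} {i} {j} =
  ⇔-trans T-∨ (T-dec (suc (toℕ i) ℕ.≟ toℕ j) ⊎-⇔
  ⇔-trans T-∨ (T-dec (suc (toℕ j) ℕ.≟ toℕ i) ⊎-⇔
  ⇔-trans T-∨ (T-both (suc (toℕ i) ℕ.≟ N) (toℕ j ℕ.≟ 0) ⊎-⇔ T-both (suc (toℕ j) ℕ.≟ N) (toℕ i ℕ.≟ 0))))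
  where
  T-both : ∀ {P Q : Set} (p : Dec P) (q : Dec Q) → T (⌊ p ⌋ ∧ ⌊ q ⌋) ⇔ (P × Q)
  T-both p q = ⇔-trans T-∧ (T-dec p ×-⇔ T-dec q)

cycAdj-sym : ∀ N i j → cycAdj N i j ≡ cycAdj N j i
cycAdj-sym N i j = begin
  a ∨ (b ∨ (c ∨ d)) ≡⟨ sym (∨-assoc a b (c ∨ d)) ⟩
  (a ∨ b) ∨ (c ∨ d) ≡⟨ cong₂ _∨_ (∨-comm a b) (∨-comm c d) ⟩
  (b ∨ a) ∨ (d ∨ c) ≡⟨ ∨-assoc b a (d ∨ c) ⟩
  b ∨ (a ∨ (d ∨ c)) ∎
  where
  a = ⌊ suc (toℕ i) ℕ.≟ toℕ j ⌋
  b = ⌊ suc (toℕ j) ℕ.≟ toℕ i ⌋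
  c = ⌊ suc (toℕ i) ℕ.≟ N ⌋ ∧ ⌊ toℕ j ℕ.≟ 0 ⌋
  d = ⌊ suc (toℕ j) ℕ.≟ N ⌋ ∧ ⌊ toℕ i ℕ.≟ 0 ⌋

record Neighbours (N a b₁ b₂ : ℕ) : Set where
  field
    b₁≢a      : b₁ ≢ a
    b₂≢a      : b₂ ≢ a
    b₂≢b₁     : b₂ ≢ b₁
    adjacent₁ : CycleAdjacent N a b₁
    adjacent₂ : CycleAdjacent N a b₂
    only      : ∀ {b} → b < N → CycleAdjacent N a b → b ≡ b₁ ⊎ b ≡ b₂

neighbours-first : ∀ m → Neighbours (3 ℕ.+ m) 0 1 (2 ℕ.+ m)
neighbours-first m = record
  { b₁≢a = λ ()
  ; b₂≢a = λ ()
  ; b₂≢b₁ = λ ()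
  ; adjacent₁ = inj₁ refl
  ; adjacent₂ = inj₂ (inj₂ (inj₂ (refl , refl)))
  ; only = λ { _ (inj₁ refl) → inj₁ refl
             ; _ (inj₂ (inj₁ ()))
             ; _ (inj₂ (inj₂ (inj₁ (() , _))))
             ; _ (inj₂ (inj₂ (inj₂ (refl , _)))) → inj₂ refl }
  }

neighbours-inner : ∀ {N} k → 2 ℕ.+ k < N → Neighbours N (1 ℕ.+ k) k (2 ℕ.+ k)
neighbours-inner k 2+k<N = record
  { b₁≢a = ℕ.1+n≢n ∘ sym
  ; b₂≢a = ℕ.1+n≢n
  ; b₂≢b₁ = ℕ.<⇒≢ (ℕ.m<n⇒m<1+n (ℕ.n<1+n k)) ∘ sym
  ; adjacent₁ = inj₂ (inj₁ refl)
  ; adjacent₂ = inj₁ refl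
  ; only = λ { _ (inj₁ refl) → inj₂ refl
             ; _ (inj₂ (inj₁ refl)) → inj₁ refl
             ; _ (inj₂ (inj₂ (inj₁ (2+k≡N , _)))) → contradiction 2+k≡N (ℕ.<⇒≢ 2+k<N)
             ; _ (inj₂ (inj₂ (inj₂ (_ , ())))) }
  }

neighbours-last : ∀ m → Neighbours (3 ℕ.+ m) (2 ℕ.+ m) (1 ℕ.+ m) 0
neighbours-last m = record
  { b₁≢a = ℕ.1+n≢n ∘ sym
  ; b₂≢a = λ ()
  ; b₂≢b₁ = λ ()
  ; adjacent₁ = inj₂ (inj₁ refl)
  ; adjacent₂ = inj₂ (inj₂ (inj₁ (refl , refl)))
  ; only = λ { b<N (inj₁ refl) → contradiction b<N (ℕ.<-irrefl refl)
             ; _ (inj₂ (inj₁ refl)) → inj₁ refl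
             ; _ (inj₂ (inj₂ (inj₁ (_ , refl)))) → inj₂ refl
             ; _ (inj₂ (inj₂ (inj₂ (_ , ())))) }
  }

-- Reduction mod suc n only serves to make vertex total; it is used only for k < suc n.
vertex : ∀ {n} → ℕ → Fin (suc n)
vertex {n} k = k mod suc n

toℕ-vertex : ∀ {n k} → k < suc n → toℕ (vertex {n} k) ≡ k
toℕ-vertex {n} {k} k<1+n = trans (toℕ-fromℕ< (m%n<n k (suc n))) (m<n⇒m%n≡m k<1+n)

vertex-toℕ : ∀ {n} (i : Fin (suc n)) → vertex (toℕ i) ≡ i
vertex-toℕ i = toℕ-injective (toℕ-vertex (toℕ<n i))

neighbours-vertex : ∀ {n a b₁ b₂} → a < suc n → b₁ < suc n → b₂ < suc n → Neighbours (suc n) a b₁ b₂ →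
                    Neighbours (suc n) (toℕ (vertex {n} a)) (toℕ (vertex {n} b₁)) (toℕ (vertex {n} b₂))
neighbours-vertex a<N b₁<N b₂<N nb rewrite toℕ-vertex a<N | toℕ-vertex b₁<N | toℕ-vertex b₂<N = nb

-- Rows of the adjacency matrix of 𝒯ₙ

entry : Bool → ℚ → ℚ
entry b q = if b then q else 0ℚ

entry-true : ∀ {b} q → T b → entry b q ≡ q
entry-true {true} q _ = refl

entry-false : ∀ {b} q → ¬ T b → entry b q ≡ 0ℚ
entry-false {false} q _  = refl
entry-false {true}  q ¬t = contradiction _ ¬t

indicator*≡entry : ∀ b q → (if b then 1ℚ else 0ℚ) * q ≡ entry b q
indicator*≡entry true  q = *-identityˡ q
indicator*≡entry false q = *-zeroˡ q

fibre : ∀ n → Fin n × Fin 3 → (Fin n → Fin 3 → ℚ) → Fin n → ℚ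
fibre n p y j = sum (λ b → entry (TAdjPair n p (j , b)) (y j b))

pairRow : ∀ n → Fin n × Fin 3 → (Fin n → Fin 3 → ℚ) → ℚ
pairRow n p y = sum (fibre n p y)

pairRow-cong : ∀ n p {y z : Fin n → Fin 3 → ℚ} → (∀ j b → y j b ≡ z j b) → pairRow n p y ≡ pairRow n p z
pairRow-cong n p y≗z = sum-cong-≗ λ j → sum-cong-≗ λ b → cong (entry (TAdjPair n p (j , b))) (y≗z j b)

adjMatrix-row≡pairRow : ∀ n (x : Fin (n ℕ.* 3) → ℚ) u →
  sumℚ (λ v → adjMatrix (TAdj n) u v * x v) ≡ pairRow n (remQuot 3 u) (λ j b → x (combine j b))
adjMatrix-row≡pairRow n x u = begin
  sumℚ (λ v → adjMatrix (TAdj n) u v * x v)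
    ≡⟨ sumℚ≡sum row ⟩
  sum row
    ≡⟨ sum-combine n row ⟩
  sum (λ (j : Fin n) → sum (λ (b : Fin 3) → row (combine j b)))
    ≡⟨ sum-cong-≗ (λ j → sum-cong-≗ λ b → trans
         (cong (λ q → (if TAdjPair n (remQuot 3 u) q then 1ℚ else 0ℚ) * x (combine j b)) (remQuot-combine j b))
         (indicator*≡entry (TAdjPair n (remQuot 3 u) (j , b)) (x (combine j b)))) ⟩
  pairRow n (remQuot 3 u) (λ j b → x (combine j b))
    ∎
  where
  row : Fin (n ℕ.* 3) → ℚ
  row v = adjMatrix (TAdj n) u v * x v

InKernel⇔pairRows : ∀ n (x : Fin (n ℕ.* 3) → ℚ) →
  InKernel (TAdj n) x ⇔ (∀ i a → pairRow n (i , a) (λ j b → x (combine j b)) ≡ 0ℚ)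
InKernel⇔pairRows n x = mk⇔
  (λ hx i a → trans (cong (λ p → pairRow n p (λ j b → x (combine j b))) (sym (remQuot-combine i a)))
                    (trans (sym (adjMatrix-row≡pairRow n x (combine i a))) (hx (combine i a))))
  (λ rows u → trans (adjMatrix-row≡pairRow n x u) (rows (proj₁ (remQuot {n} 3 u)) (proj₂ (remQuot {n} 3 u))))

TAdjPair-same : ∀ n i a b → TAdjPair n (i , a) (i , b) ≡ not ⌊ a Fin.≟ b ⌋
TAdjPair-same n i a b with i Fin.≟ i
... | yes _  = refl
... | no i≢i = contradiction refl i≢i

TAdjPair-other : ∀ n {i j} a b → j ≢ i →
  TAdjPair n (i , a) (j , b) ≡ (⌊ toℕ a ℕ.≟ 0 ⌋ ∧ ⌊ toℕ b ℕ.≟ 0 ⌋ ∧ cycAdj n i j)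
TAdjPair-other n {i} {j} a b j≢i with i Fin.≟ j
... | yes i≡j = contradiction (sym i≡j) j≢i
... | no _    = refl

fibre-same : ∀ n i a y → fibre n (i , a) y i ≡ sum (λ b → entry (not ⌊ a Fin.≟ b ⌋) (y i b))
fibre-same n i a y = sum-cong-≗ λ b → cong (λ t → entry t (y i b)) (TAdjPair-same n i a b)

fibre-cycle : ∀ n {i j} y → j ≢ i → fibre n (i , 0F) y j ≡ entry (cycAdj n i j) (y j 0F)
fibre-cycle n {i} {j} y j≢i = begin
  fibre n (i , 0F) y j                       ≡⟨ sum-cong-≗ (λ b → cong (λ t → entry t (y j b)) (TAdjPair-other n 0F b j≢i)) ⟩
  entry (cycAdj n i j) (y j 0F) + 0ℚ         ≡⟨ +-identityʳ _ ⟩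
  entry (cycAdj n i j) (y j 0F)              ∎

fibre-triangle : ∀ n {i j} (a : Fin 2) y → j ≢ i → fibre n (i , suc a) y j ≡ 0ℚ
fibre-triangle n {j = j} a y j≢i = sum-vanishing λ b → cong (λ t → entry t (y j b)) (TAdjPair-other n (suc a) b j≢i)

pairRow-triangle : ∀ n i (a : Fin 2) y →
  pairRow n (i , suc a) y ≡ sum (λ b → entry (not ⌊ suc a Fin.≟ b ⌋) (y i b))
pairRow-triangle n i a y = trans (sum-support₁ i λ j j≢i → fibre-triangle n a y j≢i) (fibre-same n i (suc a) y)

pairRow-cycle : ∀ n {i j₁ j₂} y → Neighbours n (toℕ i) (toℕ j₁) (toℕ j₂) →
  pairRow n (i , 0F) y ≡ sum (λ b → entry (not ⌊ 0F Fin.≟ b ⌋) (y i b)) + (y j₁ 0F + y j₂ 0F)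
pairRow-cycle n {i} {j₁} {j₂} y nb = begin
  pairRow n (i , 0F) y
    ≡⟨ sum-support₃ (b₁≢a ∘ cong toℕ) (b₂≢a ∘ cong toℕ) (b₂≢b₁ ∘ cong toℕ) elsewhere ⟩
  fibre n (i , 0F) y i + (fibre n (i , 0F) y j₁ + fibre n (i , 0F) y j₂)
    ≡⟨ cong₂ _+_ (fibre-same n i 0F y) (cong₂ _+_ (neighbour (b₁≢a ∘ cong toℕ) adjacent₁)
                                                   (neighbour (b₂≢a ∘ cong toℕ) adjacent₂)) ⟩
  sum (λ b → entry (not ⌊ 0F Fin.≟ b ⌋) (y i b)) + (y j₁ 0F + y j₂ 0F)
    ∎
  where
  open Neighbours nb
  neighbour : ∀ {j} → j ≢ i → CycleAdjacent n (toℕ i) (toℕ j) → fibre n (i , 0F) y j ≡ y j 0F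
  neighbour j≢i adj = trans (fibre-cycle n y j≢i) (entry-true _ (Equivalence.from T-cycAdj adj))
  elsewhere : ∀ j → j ≢ i → j ≢ j₁ → j ≢ j₂ → fibre n (i , 0F) y j ≡ 0ℚ
  elsewhere j j≢i j≢j₁ j≢j₂ = trans (fibre-cycle n y j≢i) (entry-false _ λ t →
    [ j≢j₁ ∘ toℕ-injective , j≢j₂ ∘ toℕ-injective ]′ (only (toℕ<n j) (Equivalence.to T-cycAdj t)))

-- The kernel of 𝒯ₙ

nutWeight : Fin 3 → ℚ
nutWeight 0F      = 1ℚ
nutWeight (suc _) = - 1ℚ

nutVector : ∀ n → Fin (n ℕ.* 3) → ℚ
nutVector n u = nutWeight (proj₂ (remQuot {n} 3 u))

module _ (m : ℕ) where

  private
    N : ℕ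
    N = 3 ℕ.+ m

  cycle-neighbours : ∀ i → ∃₂ λ (j₁ j₂ : Fin N) → Neighbours N (toℕ i) (toℕ j₁) (toℕ j₂)
  cycle-neighbours i = subst (λ i → ∃₂ λ (j₁ j₂ : Fin N) → Neighbours N (toℕ i) (toℕ j₁) (toℕ j₂))
                       (vertex-toℕ i) (neighbours-of (toℕ i) (toℕ<n i))
    where
    neighbours-of : ∀ a → a < N → ∃₂ λ (j₁ j₂ : Fin N) → Neighbours N (toℕ (vertex a)) (toℕ j₁) (toℕ j₂)
    neighbours-of zero    0<N   = _ , _ , neighbours-vertex 0<N (s≤s (s≤s z≤n)) ℕ.≤-refl (neighbours-first m)
    neighbours-of (suc k) 1+k<N with 2 ℕ.+ k ℕ.<? N
    ... | yes 2+k<N = _ , _ , neighbours-vertex 1+k<N (ℕ.<-trans (ℕ.n<1+n k) 1+k<N) 2+k<N (neighbours-inner k 2+k<N)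
    ... | no  2+k≮N with ℕ.≤-antisym 1+k<N (ℕ.≮⇒≥ 2+k≮N)
    ...   | refl = _ , _ , neighbours-vertex 1+k<N (ℕ.<-trans (ℕ.n<1+n (suc m)) 1+k<N) (s≤s z≤n) (neighbours-last m)

  nutWeight-rows : ∀ i a → pairRow N (i , a) (λ _ b → nutWeight b) ≡ 0ℚ
  nutWeight-rows i 0F with cycle-neighbours i
  ... | _ , _ , nb = pairRow-cycle N (λ _ b → nutWeight b) nb
  nutWeight-rows i 1F = pairRow-triangle N i 0F (λ _ b → nutWeight b)
  nutWeight-rows i 2F = pairRow-triangle N i 1F (λ _ b → nutWeight b)

  nutVector-inKernel : InKernel (TAdj N) (nutVector N)
  nutVector-inKernel = Equivalence.from (InKernel⇔pairRows N (nutVector N)) λ i a →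
    trans (pairRow-cong N (i , a) λ j b → cong (nutWeight ∘ proj₂) (remQuot-combine j b)) (nutWeight-rows i a)

  module _ (x : Fin (N ℕ.* 3) → ℚ) (hx : InKernel (TAdj N) x) where

    private
      y : Fin N → Fin 3 → ℚ
      y j b = x (combine j b)

      rows : ∀ i a → pairRow N (i , a) y ≡ 0ℚ
      rows = Equivalence.to (InKernel⇔pairRows N x) hx

    triangle₁ : ∀ i → y i 1F ≡ - y i 0F
    triangle₁ i = inverseʳ-unique (y i 0F) (y i 1F) (begin
      y i 0F + y i 1F                     ≡⟨ solve 2 (λ p q → p :+ q := p :+ (q :+ (con 0ℚ :+ con 0ℚ))) refl (y i 0F) (y i 1F) ⟩
      y i 0F + (y i 1F + (0ℚ + 0ℚ))       ≡⟨ trans (sym (pairRow-triangle N i 1F y)) (rows i 2F) ⟩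
      0ℚ                                  ∎)

    triangle₂ : ∀ i → y i 2F ≡ - y i 0F
    triangle₂ i = inverseʳ-unique (y i 0F) (y i 2F) (begin
      y i 0F + y i 2F                     ≡⟨ solve 2 (λ p q → p :+ q := p :+ (con 0ℚ :+ (q :+ con 0ℚ))) refl (y i 0F) (y i 2F) ⟩
      y i 0F + (0ℚ + (y i 2F + 0ℚ))       ≡⟨ trans (sym (pairRow-triangle N i 0F y)) (rows i 1F) ⟩
      0ℚ                                  ∎)

    cycle-balance : ∀ {i j₁ j₂} → Neighbours N (toℕ i) (toℕ j₁) (toℕ j₂) → y j₁ 0F + y j₂ 0F ≡ y i 0F + y i 0F
    cycle-balance {i} {j₁} {j₂} nb = begin
      y j₁ 0F + y j₂ 0F                      ≡⟨ inverseʳ-unique _ _ (trans (sym (pairRow-cycle N y nb)) (rows i 0F)) ⟩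
      - (0ℚ + (y i 1F + (y i 2F + 0ℚ)))      ≡⟨ cong₂ (λ p q → - (0ℚ + (p + (q + 0ℚ)))) (triangle₁ i) (triangle₂ i) ⟩
      - (0ℚ + (- y i 0F + (- y i 0F + 0ℚ)))  ≡⟨ solve 1 (λ p → :- (con 0ℚ :+ (:- p :+ (:- p :+ con 0ℚ))) := p :+ p) refl (y i 0F) ⟩
      y i 0F + y i 0F                        ∎

    private
      s : ℕ → ℚ
      s k = y (vertex k) 0F

      d : ℚ
      d = s 1 - s 0

    cycle-arithmetic : ∀ k → k < N → s k ≡ s 0 + k · d
    cycle-arithmetic = harmonic⇒arithmetic s N λ k 2+k<N →
      let 1+k<N = ℕ.<-trans (ℕ.n<1+n (suc k)) 2+k<N in
      cycle-balance (neighbours-vertex 1+k<N (ℕ.<-trans (ℕ.n<1+n k) 1+k<N) 2+k<N (neighbours-inner k 2+k<N))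

    -- The progression closes up through vertex 0, whose neighbours are 1 and N ∸ 1.
    difference≡0 : d ≡ 0ℚ
    difference≡0 = ·-cancelˡ (2 ℕ.+ m) (trans N·d≡0 (sym (·-zeroʳ N)))
      where
      wrap : (s 0 + 1 · d) + (s 0 + (2 ℕ.+ m) · d) ≡ s 0 + s 0
      wrap = trans (cong₂ _+_ (sym (cycle-arithmetic 1 (s≤s (s≤s z≤n)))) (sym (cycle-arithmetic (2 ℕ.+ m) ℕ.≤-refl)))
                   (cycle-balance (neighbours-vertex (s≤s z≤n) (s≤s (s≤s z≤n)) ℕ.≤-refl (neighbours-first m)))
      N·d≡0 : N · d ≡ 0ℚ
      N·d≡0 = begin
        d + (2 ℕ.+ m) · d
          ≡⟨ solve 3 (λ s₀ d t → d :+ t := ((s₀ :+ (d :+ con 0ℚ)) :+ (s₀ :+ t)) :+ :- (s₀ :+ s₀)) refl (s 0) d ((2 ℕ.+ m) · d) ⟩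
        ((s 0 + 1 · d) + (s 0 + (2 ℕ.+ m) · d)) - (s 0 + s 0)
          ≡⟨ cong (_- (s 0 + s 0)) wrap ⟩
        (s 0 + s 0) - (s 0 + s 0)
          ≡⟨ solve 1 (λ s₀ → (s₀ :+ s₀) :+ :- (s₀ :+ s₀) := con 0ℚ) refl (s 0) ⟩
        0ℚ
          ∎

    cycle-constant : ∀ i → y i 0F ≡ s 0
    cycle-constant i = begin
      y i 0F            ≡⟨ cong (λ j → y j 0F) (sym (vertex-toℕ i)) ⟩
      s (toℕ i)         ≡⟨ cycle-arithmetic (toℕ i) (toℕ<n i) ⟩
      s 0 + toℕ i · d   ≡⟨ cong (λ t → s 0 + toℕ i · t) difference≡0 ⟩
      s 0 + toℕ i · 0ℚ  ≡⟨ cong (s 0 +_) (·-zeroʳ (toℕ i)) ⟩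
      s 0 + 0ℚ          ≡⟨ +-identityʳ (s 0) ⟩
      s 0               ∎

    kernel-pairs-multiple : ∀ i a → y i a ≡ s 0 * nutWeight a
    kernel-pairs-multiple i 0F = trans (cycle-constant i) (sym (*-identityʳ (s 0)))
    kernel-pairs-multiple i 1F = trans (triangle₁ i) (trans (cong -_ (kernel-pairs-multiple i 0F)) (neg-distribʳ-* (s 0) 1ℚ))
    kernel-pairs-multiple i 2F = trans (triangle₂ i) (trans (cong -_ (kernel-pairs-multiple i 0F)) (neg-distribʳ-* (s 0) 1ℚ))

    kernel-multiple : ∃ λ c → ∀ u → x u ≡ c * nutVector N u
    kernel-multiple = s 0 , λ u →
      trans (cong x (sym (combine-remQuot {N} 3 u))) (kernel-pairs-multiple (proj₁ (remQuot {N} 3 u)) (proj₂ (remQuot {N} 3 u)))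

  TAdj-nutKernel : NutKernel (TAdj N)
  TAdj-nutKernel = nutVector N , nutWeight-nonzero ∘ proj₂ ∘ remQuot {N} 3 , nutVector-inKernel , kernel-multiple
    where
    nutWeight-nonzero : ∀ a → nutWeight a ≢ 0ℚ
    nutWeight-nonzero 0F      ()
    nutWeight-nonzero (suc _) ()

-- Simplicity and connectedness

⌊≟⌋-sym : ∀ {n} (a b : Fin n) → ⌊ a Fin.≟ b ⌋ ≡ ⌊ b Fin.≟ a ⌋
⌊≟⌋-sym a b with a Fin.≟ b | b Fin.≟ a
... | yes _   | yes _   = refl
... | no  _   | no  _   = refl
... | yes a≡b | no  b≢a = contradiction (sym a≡b) b≢a
... | no  a≢b | yes b≡a = contradiction (sym b≡a) a≢b

TAdjPair-sym : ∀ n p q → TAdjPair n p q ≡ TAdjPair n q p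
TAdjPair-sym n (i , a) (j , b) with i Fin.≟ j | j Fin.≟ i
... | yes _   | yes _   = cong not (⌊≟⌋-sym a b)
... | yes i≡j | no  j≢i = contradiction (sym i≡j) j≢i
... | no  i≢j | yes j≡i = contradiction (sym j≡i) i≢j
... | no  _   | no  _   = begin
  α ∧ (β ∧ cycAdj n i j) ≡⟨ sym (∧-assoc α β _) ⟩
  (α ∧ β) ∧ cycAdj n i j ≡⟨ cong₂ _∧_ (∧-comm α β) (cycAdj-sym n i j) ⟩
  (β ∧ α) ∧ cycAdj n j i ≡⟨ ∧-assoc β α _ ⟩
  β ∧ (α ∧ cycAdj n j i) ∎
  where
  α = ⌊ toℕ a ℕ.≟ 0 ⌋
  β = ⌊ toℕ b ℕ.≟ 0 ⌋

TAdjPair-irrefl : ∀ n p → TAdjPair n p p ≡ false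
TAdjPair-irrefl n (i , a) with i Fin.≟ i | a Fin.≟ a
... | yes _   | yes _   = refl
... | yes _   | no  a≢a = contradiction refl a≢a
... | no  i≢i | _       = contradiction refl i≢i

TAdj-simple : ∀ n → IsSimple (TAdj n)
TAdj-simple n = (λ u v → TAdjPair-sym n (remQuot 3 u) (remQuot 3 v)) , (λ u → TAdjPair-irrefl n (remQuot 3 u))

Reach-trans : ∀ {m} {adj : Adj m} {u v t} → Reach adj u v → Reach adj v t → Reach adj u t
Reach-trans here           r = r
Reach-trans (step e r₁) r₂ = step e (Reach-trans r₁ r₂)

Reach-sym : ∀ {m} {adj : Adj m} → (∀ u v → adj u v ≡ adj v u) → ∀ {u v} → Reach adj u v → Reach adj v u
Reach-sym sym-adj here                 = here
Reach-sym sym-adj (step {u} {t} e r) = Reach-trans (Reach-sym sym-adj r) (step (trans (sym-adj t u) e) here)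

TAdj-combine : ∀ n i a j b → TAdj n (combine i a) (combine j b) ≡ TAdjPair n (i , a) (j , b)
TAdj-combine n i a j b = cong₂ (TAdjPair n) (remQuot-combine i a) (remQuot-combine j b)

module _ (m : ℕ) where

  private
    N : ℕ
    N = 3 ℕ.+ m

  root : Fin (N ℕ.* 3)
  root = combine {N} {3} (vertex 0) 0F

  cycle-to-root : ∀ k → k < N → Reach (TAdj N) (combine {N} {3} (vertex k) 0F) root
  cycle-to-root zero    _     = here
  cycle-to-root (suc k) 1+k<N = step edge (cycle-to-root k k<N)
    where
    k<N = ℕ.<-trans (ℕ.n<1+n k) 1+k<N
    adjacent : CycleAdjacent N (toℕ (vertex (suc k))) (toℕ (vertex k))
    adjacent = subst₂ (CycleAdjacent N) (sym (toℕ-vertex 1+k<N)) (sym (toℕ-vertex k<N)) (inj₂ (inj₁ refl))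
    distinct : vertex k ≢ vertex (suc k)
    distinct e = ℕ.1+n≢n (trans (sym (toℕ-vertex 1+k<N)) (trans (cong toℕ (sym e)) (toℕ-vertex k<N)))
    edge : TAdj N (combine {N} {3} (vertex (suc k)) 0F) (combine {N} {3} (vertex k) 0F) ≡ true
    edge = trans (TAdj-combine N (vertex (suc k)) 0F (vertex k) 0F)
                 (trans (TAdjPair-other N 0F 0F distinct) (Equivalence.to T-≡ (Equivalence.from T-cycAdj adjacent)))

  pair-to-root : ∀ (i : Fin N) (a : Fin 3) → Reach (TAdj N) (combine i a) root
  pair-to-root i 0F      = subst (λ j → Reach (TAdj N) (combine {N} {3} j 0F) root) (vertex-toℕ i) (cycle-to-root (toℕ i) (toℕ<n i))
  pair-to-root i (suc a) = step (trans (TAdj-combine N i (suc a) i 0F) (TAdjPair-same N i (suc a) 0F)) (pair-to-root i 0F)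

  TAdj-connected : Connected (TAdj N)
  TAdj-connected u v = Reach-trans (to-root u) (Reach-sym (proj₁ (TAdj-simple N)) (to-root v))
    where
    to-root : ∀ u → Reach (TAdj N) u root
    to-root u = subst (λ v → Reach (TAdj N) v root) (combine-remQuot {N} 3 u)
                      (pair-to-root (proj₁ (remQuot {N} 3 u)) (proj₂ (remQuot {N} 3 u)))

proposition14 : ∀ n → 3 ≤ n → IsNutGraph (TAdj n)
proposition14 (suc (suc (suc m))) (s≤s (s≤s (s≤s _))) = TAdj-simple _ , TAdj-connected m , TAdj-nutKernel m
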